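{- Let $G=(V,E)$ be a graph, $k\ge 1$, and let $v\in V$ be large-sparse. Let $B\subseteq V\setminus\{v\}$ with $|B|\le 2k$ be such that $G-B$ contains no cycle passing through $v$. Let $\mathcal{C}_{\mathrm{tree}}$ be the family of connected components of $G-v-B$ that are adjacent to $v$ and are trees. If some $C\in\mathcal{C}_{\mathrm{tree}}$ has no neighbor in $B$, then $(G,k)$ is a yes-instance of \textsc{Cliques or Trees Vertex Deletion} if and only if $(G-C,k)$ is a yes-instance.
   Context: Graphs are undirected, without self-loops, possibly with multi-edges (a pair of parallel edges forms a cycle). $N(v)$ is the neighbor set; $\rho(v)$ is the number of unordered pairs of neighbors of $v$ that are adjacent (parallel edges counted once). A vertex $v$ is large-sparse if $|N(v)|>7k$ and $\rho(v)\le |N(v)|(|N(v)|-1)/4$. \textsc{Cliques or Trees Vertex Deletion}: given $(G,k)$, decide whether there is $X\subseteq V$ with $|X|\le k$ such that every component of $G-X$ is a clique (exactly one edge between any two distinct vertices) or a tree (connected, acyclic). -}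

module Defs where

open import Data.Nat using (ℕ; zero; suc; _*_; _∸_; _≤_; _<_)
open import Data.Fin using (Fin; toℕ; _≟_) renaming (_<?_ to _<ᶠ?_; _<_ to _<ᶠ_)
open import Data.Fin.Subset using (Subset; _∈_; _∉_; _⊆_; ∁; _∩_; _∪_; ⁅_⁆; ∣_∣; ⊤)
open import Data.Fin.Subset.Properties using (_∈?_)
open import Data.List using (List; length; lookup; filter; allFin; cartesianProduct)
open import Data.List.Relation.Unary.All using (All)
open import Data.List.Relation.Unary.Any using (Any; any?)
open import Data.Product using (Σ; ∃; _×_; _,_; proj₁; proj₂)
open import Data.Product.Properties using ()
open import Data.Sum using (_⊎_)
open import Data.Vec using (tabulate)
open import Relation.Nullary using (¬_; Dec; does)
open import Relation.Nullary.Decidable using (_×-dec_; _⊎-dec_)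
open import Relation.Binary.PropositionalEquality using (_≡_; _≢_)

-- A finite multigraph (no self-loops, parallel edges allowed) on vertex set Fin n,
-- given by its list of edges; edges are identified by their index in the list.
record Graph (n : ℕ) : Set where
  field
    edges    : List (Fin n × Fin n)
    loopless : All (λ e → proj₁ e ≢ proj₂ e) edges

open Graph public

module _ {n : ℕ} (G : Graph n) where

  EdgeIx : Set
  EdgeIx = Fin (length (edges G))

  JoinsE : Fin n × Fin n → Fin n → Fin n → Set
  JoinsE e a b = (proj₁ e ≡ a × proj₂ e ≡ b) ⊎ (proj₁ e ≡ b × proj₂ e ≡ a)

  joinsE? : ∀ e a b → Dec (JoinsE e a b)
  joinsE? e a b = ((proj₁ e ≟ a) ×-dec (proj₂ e ≟ b)) ⊎-dec ((proj₁ e ≟ b) ×-dec (proj₂ e ≟ a))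

  Joins : EdgeIx → Fin n → Fin n → Set
  Joins i a b = JoinsE (lookup (edges G) i) a b

  edgeCount : Fin n → Fin n → ℕ
  edgeCount a b = length (filter (λ e → joinsE? e a b) (edges G))

  Adj : Fin n → Fin n → Set
  Adj a b = Any (λ e → JoinsE e a b) (edges G)

  adj? : ∀ a b → Dec (Adj a b)
  adj? a b = any? (λ e → joinsE? e a b) (edges G)

  nbhd : Fin n → Subset n
  nbhd v = tabulate (λ u → does (adj? v u))

  rho : Fin n → ℕ
  rho v = length (filter
    (λ p → (proj₁ p <ᶠ? proj₂ p) ×-dec ((proj₁ p ∈? nbhd v) ×-dec ((proj₂ p ∈? nbhd v) ×-dec adj? (proj₁ p) (proj₂ p))))
    (cartesianProduct (allFin n) (allFin n)))

  -- v is large-sparse: |N(v)| > 7k and ρ(v) ≤ |N(v)|(|N(v)|-1)/4  (multiplied out by 4)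
  LargeSparse : ℕ → Fin n → Set
  LargeSparse k v = (7 * k < ∣ nbhd v ∣) × (4 * rho v ≤ ∣ nbhd v ∣ * (∣ nbhd v ∣ ∸ 1))

  record Cycle (S : Subset n) : Set where
    field
      len     : ℕ
      len≥2   : 2 ≤ len
      vtx     : Fin len → Fin n
      edg     : Fin len → EdgeIx
      vtx-inj : ∀ i j → vtx i ≡ vtx j → i ≡ j
      edg-inj : ∀ i j → edg i ≡ edg j → i ≡ j
      vtx-in  : ∀ i → vtx i ∈ S
      link    : ∀ (i j : Fin len) →
                (suc (toℕ i) ≡ toℕ j ⊎ (suc (toℕ i) ≡ len × toℕ j ≡ 0)) →
                Joins (edg i) (vtx i) (vtx j)

  data Reach (S : Subset n) : Fin n → Fin n → Set where
    here : ∀ {a} → a ∈ S → Reach S a a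
    step : ∀ {a b c} → a ∈ S → Adj a b → Reach S b c → Reach S a c

  Connected : Subset n → Set
  Connected C = ∀ a b → a ∈ C → b ∈ C → Reach C a b

  IsComponent : Subset n → Subset n → Set
  IsComponent S C =
    (∃ λ a → a ∈ C) × C ⊆ S × Connected C ×
    (∀ a b → a ∈ C → b ∈ S → Reach S a b → b ∈ C)

  IsClique : Subset n → Set
  IsClique C = ∀ a b → a ∈ C → b ∈ C → a ≢ b → edgeCount a b ≡ 1

  IsTree : Subset n → Set
  IsTree C = (∃ λ a → a ∈ C) × Connected C × ¬ Cycle C

  Solution : Subset n → ℕ → Subset n → Set
  Solution S k X = X ⊆ S × ∣ X ∣ ≤ k ×
    (∀ C → IsComponent (S ∩ ∁ X) C → IsClique C ⊎ IsTree C)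

  YesInstance : Subset n → ℕ → Set
  YesInstance S k = ∃ λ X → Solution S k X

{-# OPTIONS --safe #-}
-- Restricting a solution X of G to G − C keeps it a solution: every component of (G − C) − X
-- lies in a component of G − X, and cliques and trees stay so on connected subsets.
-- Conversely let Y solve G − C. Since v is the only vertex outside C adjacent to C, a cycle
-- meeting C lies in C ∪ {v}; it is then either a cycle of the tree C or a cycle through v
-- avoiding B, so no cycle meets C. Hence a component D of G − Y meeting C can only fail to be
-- a tree by a cycle in D − C. Then v ∉ Y (otherwise D ⊆ C) and D − C is the component of
-- (G − C) − Y containing v, so it is a tree or a clique. A clique is impossible: it contains every
-- neighbour of v outside C ∪ Y, two of which outside B would close a triangle through v avoiding B,
-- while two neighbours of v in C would close a cycle through v in C ∪ {v}; so
-- deg v ≤ |Y| + |B| + 2 ≤ 3k + 2 ≤ 7k.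

module Submission where

open import Defs
open import Data.Empty using (⊥; ⊥-elim)
open import Data.Fin using (Fin; zero; suc; toℕ; fromℕ<; _≟_)
open import Data.Fin.Properties using (toℕ-injective; toℕ-fromℕ<; fromℕ<-toℕ; toℕ<n; any?)
open import Data.Fin.Subset
  using (Subset; _∈_; _∉_; _⊆_; _⊂_; ∁; _∩_; _∪_; ⁅_⁆; ∣_∣; ⊤; _-_; inside; outside)
open import Data.Fin.Subset.Induction using (Acc; acc; ⊂-wellFounded)
open import Data.Fin.Subset.Properties
open import Data.List using (length)
open import Data.List.Membership.Propositional using (lose)
open import Data.List.Membership.Propositional.Properties using (∈-lookup)
open import Data.List.Properties using (filter-none)
open import Data.List.Relation.Unary.All using (lookupAny)
open import Data.List.Relation.Unary.All.Properties using (¬Any⇒All¬)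
open import Data.List.Relation.Unary.Any as Any using (index)
open import Data.List.Relation.Unary.Any.Properties using (lookup-index)
open import Data.Nat using (ℕ; zero; suc; _+_; _*_; _≤_; _<_; z≤n; s≤s; _<?_; _≤?_; NonZero; >-nonZero)
open import Data.Nat.Properties
  using (≤-refl; ≤-reflexive; ≤-trans; ≤-antisym; ≤-total; <-irrefl; <-trans; <⇒≱; ≮⇒≥; <⇒≤pred;
         n≤1+n; n<1+n; m≤n⇒m≤1+n; m<n⇒m<1+n; m≤n⇒m<n∨m≡n; suc-pred; suc-injective; 0≢1+n;
         +-suc; +-assoc; +-monoʳ-≤; +-mono-≤; *-monoʳ-≤; *-distribʳ-+; module ≤-Reasoning)
open import Data.Product using (∃; _×_; _,_; proj₁; proj₂)
open import Data.Sum using (_⊎_; inj₁; inj₂; swap; reduce; fromInj₂; [_,_]′)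
open import Data.Vec using ([]; _∷_; here; there; tabulate)
open import Data.Vec.Properties using (lookup∘tabulate; []=⇒lookup; lookup⇒[]=)
open import Function using (_∘_; _⇔_; mk⇔; Equivalence)
open import Relation.Binary using (Decidable)
open import Relation.Nullary using (¬_; Dec; yes; no; does; contradiction; _×-dec_)
open import Relation.Nullary.Decidable using (dec-true; decidable-stable; map′)
open import Relation.Binary.PropositionalEquality using (_≡_; _≢_; refl; sym; trans; cong; subst; subst₂)

x∉p-x : ∀ {n} {p : Subset n} (x : Fin n) → x ∉ p - x
x∉p-x {p = _ ∷ _} zero    ()
x∉p-x {p = _ ∷ p} (suc x) (there x∈p-x) = x∉p-x {p = p} x x∈p-x

∣p∪q∣≤∣p∣+∣q∣ : ∀ {n} (p q : Subset n) → ∣ p ∪ q ∣ ≤ ∣ p ∣ + ∣ q ∣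
∣p∪q∣≤∣p∣+∣q∣ []            []            = z≤n
∣p∪q∣≤∣p∣+∣q∣ (inside  ∷ p) (inside  ∷ q) = s≤s (≤-trans (∣p∪q∣≤∣p∣+∣q∣ p q) (+-monoʳ-≤ ∣ p ∣ (n≤1+n ∣ q ∣)))
∣p∪q∣≤∣p∣+∣q∣ (inside  ∷ p) (outside ∷ q) = s≤s (∣p∪q∣≤∣p∣+∣q∣ p q)
∣p∪q∣≤∣p∣+∣q∣ (outside ∷ p) (inside  ∷ q) =
  subst (suc ∣ p ∪ q ∣ ≤_) (sym (+-suc ∣ p ∣ ∣ q ∣)) (s≤s (∣p∪q∣≤∣p∣+∣q∣ p q))
∣p∪q∣≤∣p∣+∣q∣ (outside ∷ p) (outside ∷ q) = ∣p∪q∣≤∣p∣+∣q∣ p q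

subsingleton⇒∣p∣≤1 : ∀ {n} (p : Subset n) → (∀ {x y} → x ∈ p → y ∈ p → x ≡ y) → ∣ p ∣ ≤ 1
subsingleton⇒∣p∣≤1 {n} p p-subsingleton with nonempty? p
... | yes (x , x∈p) = ≤-trans (p⊆q⇒∣p∣≤∣q∣ p⊆⁅x⁆) (≤-reflexive (∣⁅x⁆∣≡1 x))
  where
  p⊆⁅x⁆ : p ⊆ ⁅ x ⁆
  p⊆⁅x⁆ y∈p = subst (_∈ ⁅ x ⁆) (p-subsingleton x∈p y∈p) (x∈⁅x⁆ x)
... | no p-empty = ≤-trans (≤-reflexive (trans (cong ∣_∣ (Empty-unique p-empty)) (∣⊥∣≡0 n))) z≤n

∈-tabulate-does : ∀ {n p} {P : Fin n → Set p} (P? : ∀ x → Dec (P x)) {x} →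
                  x ∈ tabulate (does ∘ P?) ⇔ P x
∈-tabulate-does {P = P} P? {x} = mk⇔ to from
  where
  to : x ∈ tabulate (does ∘ P?) → P x
  to x∈ with P? x | trans (sym (lookup∘tabulate (does ∘ P?) x)) ([]=⇒lookup x∈)
  ... | yes px | _  = px
  ... | no  _  | ()
  from : P x → x ∈ tabulate (does ∘ P?)
  from px = lookup⇒[]= x _ (trans (lookup∘tabulate (does ∘ P?) x) (dec-true (P? x) px))

k+2k+2≤7k : ∀ {k} → 1 ≤ k → k + (2 * k + 2) ≤ 7 * k
k+2k+2≤7k {k} 1≤k = begin
  k + (2 * k + 2) ≡⟨ +-assoc k (2 * k) 2 ⟨
  3 * k + 2       ≤⟨ +-monoʳ-≤ (3 * k) (≤-trans (s≤s (s≤s z≤n)) (*-monoʳ-≤ 4 1≤k)) ⟩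
  3 * k + 4 * k   ≡⟨ *-distribʳ-+ k 3 4 ⟨
  7 * k           ∎
  where open ≤-Reasoning

CyclicSucc : ℕ → ℕ → ℕ → Set
CyclicSucc L a b = suc a ≡ b ⊎ (suc a ≡ L × b ≡ 0)

cyclicSucc : ∀ {L} (i : Fin L) → ∃ λ j → CyclicSucc L (toℕ i) (toℕ j)
cyclicSucc {L} i with suc (toℕ i) <? L
... | yes i+1<L = fromℕ< i+1<L , inj₁ (sym (toℕ-fromℕ< i+1<L))
... | no  i+1≮L = fromℕ< 0<L , inj₂ (≤-antisym (toℕ<n i) (≮⇒≥ i+1≮L) , toℕ-fromℕ< 0<L)
  where
  0<L : 0 < L
  0<L = ≤-trans (s≤s z≤n) (toℕ<n i)

cyclicSucc-unique : ∀ {L} {i j j′ : Fin L} →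
                    CyclicSucc L (toℕ i) (toℕ j) → CyclicSucc L (toℕ i) (toℕ j′) → j ≡ j′
cyclicSucc-unique             (inj₁ e)       (inj₁ e′)       = toℕ-injective (trans (sym e) e′)
cyclicSucc-unique {j = j}     (inj₁ e)       (inj₂ (e′ , _)) = ⊥-elim (<-irrefl (trans (sym e) e′) (toℕ<n j))
cyclicSucc-unique {j′ = j′}   (inj₂ (e , _)) (inj₁ e′)       = ⊥-elim (<-irrefl (trans (sym e′) e) (toℕ<n j′))
cyclicSucc-unique             (inj₂ (_ , z)) (inj₂ (_ , z′)) = toℕ-injective (trans z (sym z′))

cyclicSucc-asym : ∀ {L a b} → 3 ≤ L → CyclicSucc L a b → ¬ CyclicSucc L b a
cyclicSucc-asym {a = a} _      (inj₁ refl)          (inj₁ a+2≡a)         =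
  <-irrefl (sym a+2≡a) (m<n⇒m<1+n (n<1+n a))
cyclicSucc-asym (s≤s (s≤s ())) (inj₁ refl)          (inj₂ (refl , refl))
cyclicSucc-asym (s≤s (s≤s ())) (inj₂ (refl , refl)) (inj₁ refl)

module GraphProperties {n : ℕ} (G : Graph n) where

  private
    variable
      a b c u v x y : Fin n
      C D K S T X : Subset n
      k : ℕ

  JoinsE-unique : ∀ e → JoinsE G e a b → JoinsE G e c u → (a ≡ c × b ≡ u) ⊎ (a ≡ u × b ≡ c)
  JoinsE-unique _ (inj₁ (refl , refl)) (inj₁ (refl , refl)) = inj₁ (refl , refl)
  JoinsE-unique _ (inj₁ (refl , refl)) (inj₂ (refl , refl)) = inj₂ (refl , refl)
  JoinsE-unique _ (inj₂ (refl , refl)) (inj₁ (refl , refl)) = inj₂ (refl , refl)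
  JoinsE-unique _ (inj₂ (refl , refl)) (inj₂ (refl , refl)) = inj₁ (refl , refl)

  Adj-sym : Adj G a b → Adj G b a
  Adj-sym = Any.map swap

  Adj-irrefl : ¬ Adj G a a
  Adj-irrefl a~a with lookupAny (loopless G) a~a
  ... | e₁≢e₂ , joins = let (e₁≡a , e₂≡a) = reduce joins in e₁≢e₂ (trans e₁≡a (sym e₂≡a))

  Adj⇒Joins : Adj G a b → ∃ λ i → Joins G i a b
  Adj⇒Joins a~b = index a~b , lookup-index a~b

  Joins⇒Adj : ∀ {i} → Joins G i a b → Adj G a b
  Joins⇒Adj {i = i} = lose (∈-lookup i)

  edgeCount≡1⇒Adj : edgeCount G a b ≡ 1 → Adj G a b
  edgeCount≡1⇒Adj {a} {b} count≡1 = decidable-stable (adj? G a b) λ a≁b →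
    0≢1+n (trans (cong length (sym (filter-none (λ e → joinsE? G e a b) (¬Any⇒All¬ (edges G) a≁b)))) count≡1)

  ∈nbhd⇒Adj : x ∈ nbhd G v → Adj G v x
  ∈nbhd⇒Adj {v = v} = Equivalence.to (∈-tabulate-does (adj? G v))

  reach-start : Reach G S a b → a ∈ S
  reach-start (here a∈S)     = a∈S
  reach-start (step a∈S _ _) = a∈S

  reach-end : Reach G S a b → b ∈ S
  reach-end (here b∈S)   = b∈S
  reach-end (step _ _ r) = reach-end r

  reach-mono : S ⊆ T → Reach G S a b → Reach G T a b
  reach-mono S⊆T (here a∈S)       = here (S⊆T a∈S)
  reach-mono S⊆T (step a∈S a~x r) = step (S⊆T a∈S) a~x (reach-mono S⊆T r)

  reach-trans : Reach G S a b → Reach G S b c → Reach G S a c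
  reach-trans (here _)         r′ = r′
  reach-trans (step a∈S a~x r) r′ = step a∈S a~x (reach-trans r r′)

  reach-edge : a ∈ S → b ∈ S → Adj G a b → Reach G S a b
  reach-edge a∈S b∈S a~b = step a∈S a~b (here b∈S)

  reach-sym : Reach G S a b → Reach G S b a
  reach-sym (here a∈S)       = here a∈S
  reach-sym (step a∈S a~x r) = reach-trans (reach-sym r) (reach-edge (reach-start r) a∈S (Adj-sym a~x))

  -- The second case resumes the walk after its last visit to a.
  reach-avoid : Reach G S x b →
                Reach G (S - a) x b ⊎ (∃ λ c → Adj G a c × Reach G (S - a) c b) ⊎ a ≡ b
  reach-avoid {a = a} (here {x} x∈S) with x ≟ a
  ... | yes refl = inj₂ (inj₂ refl)
  ... | no  x≢a  = inj₁ (here (x∈p∧x≢y⇒x∈p-y x∈S x≢a))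
  reach-avoid {a = a} (step {x} {y} x∈S x~y r) with reach-avoid {a = a} r
  ... | inj₂ resumed = inj₂ resumed
  ... | inj₁ r′ with x ≟ a
  ...   | yes refl = inj₂ (inj₁ (y , x~y , r′))
  ...   | no  x≢a  = inj₁ (step (x∈p∧x≢y⇒x∈p-y x∈S x≢a) x~y r′)

  reach-leave : Reach G S a b → a ≡ b ⊎ ∃ λ c → Adj G a c × Reach G (S - a) c b
  reach-leave {a = a} r with reach-avoid {a = a} r
  ... | inj₁ r′             = contradiction (reach-start r′) (x∉p-x a)
  ... | inj₂ (inj₁ resumed) = inj₂ resumed
  ... | inj₂ (inj₂ a≡b)     = inj₁ a≡b

  reach? : ∀ S → Decidable (Reach G S)
  reach? S = go (⊂-wellFounded S)
    where
    go : ∀ {S} → Acc _⊂_ S → Decidable (Reach G S)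
    go {S} (acc smaller) a b with a ∈? S | a ≟ b
    ... | no  a∉S | _        = no (a∉S ∘ reach-start)
    ... | yes a∈S | yes refl = yes (here a∈S)
    ... | yes a∈S | no  a≢b  =
      map′ (λ (c , a~c , r) → step a∈S a~c (reach-mono (p─q⊆p S ⁅ a ⁆) r))
           (fromInj₂ (λ a≡b → contradiction a≡b a≢b) ∘ reach-leave)
           (any? λ c → adj? G a c ×-dec go (smaller (x∈p⇒p-x⊂p a∈S)) c b)

  componentOf : Subset n → Fin n → Subset n
  componentOf S a = tabulate (does ∘ reach? S a)

  ∈componentOf⁺ : Reach G S a b → b ∈ componentOf S a
  ∈componentOf⁺ {S = S} {a = a} = Equivalence.from (∈-tabulate-does (reach? S a))

  ∈componentOf⁻ : b ∈ componentOf S a → Reach G S a b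
  ∈componentOf⁻ {S = S} {a = a} = Equivalence.to (∈-tabulate-does (reach? S a))

  reach-componentOf : Reach G S a x → Reach G S x y → Reach G (componentOf S a) x y
  reach-componentOf a⇝x (here _) = here (∈componentOf⁺ a⇝x)
  reach-componentOf a⇝x (step x∈S x~z z⇝y) = step (∈componentOf⁺ a⇝x) x~z
    (reach-componentOf (reach-trans a⇝x (reach-edge x∈S (reach-start z⇝y) x~z)) z⇝y)

  componentOf-isComponent : a ∈ S → IsComponent G S (componentOf S a)
  componentOf-isComponent {a = a} {S = S} a∈S =
    (a , ∈componentOf⁺ (here a∈S)) ,
    reach-end ∘ a⇝ ,
    (λ _ _ x∈ y∈ → reach-componentOf (a⇝ x∈) (reach-trans (reach-sym (a⇝ x∈)) (a⇝ y∈))) ,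
    (λ _ _ x∈ _ x⇝y → ∈componentOf⁺ (reach-trans (a⇝ x∈) x⇝y))
    where
    a⇝ : x ∈ componentOf S a → Reach G S a x
    a⇝ = ∈componentOf⁻

  record SimplePath (S : Subset n) (a b : Fin n) : Set where
    field
      len       : ℕ
      vtx       : Fin (suc len) → Fin n
      vtx-first : vtx zero ≡ a
      vtx-last  : ∀ i → toℕ i ≡ len → vtx i ≡ b
      vtx-inj   : ∀ i j → vtx i ≡ vtx j → i ≡ j
      vtx-in    : ∀ i → vtx i ∈ S
      link      : ∀ i j → suc (toℕ i) ≡ toℕ j → Adj G (vtx i) (vtx j)

  trivialPath : a ∈ S → SimplePath S a a
  trivialPath {a = a} a∈S = record
    { len       = 0
    ; vtx       = λ _ → a
    ; vtx-first = refl
    ; vtx-last  = λ _ _ → refl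
    ; vtx-inj   = λ { zero zero _ → refl }
    ; vtx-in    = λ _ → a∈S
    ; link      = λ { zero zero () }
    }

  consPath : a ∈ S → Adj G a c → SimplePath (S - a) c b → SimplePath S a b
  consPath {a = a} {S = S} {b = b} a∈S a~c P = record
    { len       = suc len
    ; vtx       = vtx′
    ; vtx-first = refl
    ; vtx-last  = vtx′-last
    ; vtx-inj   = vtx′-inj
    ; vtx-in    = vtx′-in
    ; link      = link′
    }
    where
    open SimplePath P
    vtx′ : Fin (suc (suc len)) → Fin n
    vtx′ zero    = a
    vtx′ (suc i) = vtx i
    vtx′-last : ∀ i → toℕ i ≡ suc len → vtx′ i ≡ b
    vtx′-last (suc i) i≡len = vtx-last i (suc-injective i≡len)
    vtx′-inj : ∀ i j → vtx′ i ≡ vtx′ j → i ≡ j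
    vtx′-inj zero    zero    _   = refl
    vtx′-inj zero    (suc j) a≡  = contradiction (subst (_∈ S - a) (sym a≡) (vtx-in j)) (x∉p-x a)
    vtx′-inj (suc i) zero    ≡a  = contradiction (subst (_∈ S - a) ≡a (vtx-in i)) (x∉p-x a)
    vtx′-inj (suc i) (suc j) i≡j = cong suc (vtx-inj i j i≡j)
    vtx′-in : ∀ i → vtx′ i ∈ S
    vtx′-in zero    = a∈S
    vtx′-in (suc i) = p─q⊆p S ⁅ a ⁆ (vtx-in i)
    link′ : ∀ i j → suc (toℕ i) ≡ toℕ j → Adj G (vtx′ i) (vtx′ j)
    link′ zero    (suc zero)    _ = subst (Adj G a) (sym vtx-first) a~c
    link′ (suc i) (suc j)       e = link i j (suc-injective e)
    link′ zero    zero          ()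
    link′ zero    (suc (suc _)) ()
    link′ (suc _) zero          ()

  simplePath : Reach G S a b → SimplePath S a b
  simplePath {S = S} = go (⊂-wellFounded S)
    where
    go : ∀ {S} → Acc _⊂_ S → Reach G S a b → SimplePath S a b
    go (acc smaller) r with reach-leave r
    ... | inj₁ refl           = trivialPath (reach-start r)
    ... | inj₂ (c , a~c , r′) =
      consPath (reach-start r) a~c (go (smaller (x∈p⇒p-x⊂p (reach-start r))) r′)

  mkCycle : ∀ L → 3 ≤ L → (f : Fin L → Fin n) → (∀ i j → f i ≡ f j → i ≡ j) → (∀ i → f i ∈ S) →
            (∀ i j → CyclicSucc L (toℕ i) (toℕ j) → Adj G (f i) (f j)) → Cycle G S
  mkCycle L 3≤L f f-inj f-in f-adj = record
    { len     = L
    ; len≥2   = ≤-trans (n≤1+n 2) 3≤L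
    ; vtx     = f
    ; edg     = edg
    ; vtx-inj = f-inj
    ; edg-inj = edg-inj
    ; vtx-in  = f-in
    ; link    = link
    }
    where
    next : Fin L → Fin L
    next i = proj₁ (cyclicSucc i)
    edge : ∀ i → ∃ λ e → Joins G e (f i) (f (next i))
    edge i = Adj⇒Joins (f-adj i (next i) (proj₂ (cyclicSucc i)))
    edg : Fin L → EdgeIx G
    edg i = proj₁ (edge i)
    link : ∀ i j → CyclicSucc L (toℕ i) (toℕ j) → Joins G (edg i) (f i) (f j)
    link i j s = subst (Joins G (edg i) (f i) ∘ f) (cyclicSucc-unique (proj₂ (cyclicSucc i)) s) (proj₂ (edge i))
    edg-inj : ∀ i i′ → edg i ≡ edg i′ → i ≡ i′
    edg-inj i i′ e
      with JoinsE-unique _ (proj₂ (edge i)) (subst (λ e → Joins G e (f i′) (f (next i′))) (sym e) (proj₂ (edge i′)))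
    ... | inj₁ (fi≡fi′ , _)         = f-inj i i′ fi≡fi′
    ... | inj₂ (fi≡fni′ , fni≡fi′) = ⊥-elim (cyclicSucc-asym 3≤L i′→i i→i′)
      where
      i′→i : CyclicSucc L (toℕ i′) (toℕ i)
      i′→i = subst (CyclicSucc L (toℕ i′) ∘ toℕ) (sym (f-inj i (next i′) fi≡fni′)) (proj₂ (cyclicSucc i′))
      i→i′ : CyclicSucc L (toℕ i) (toℕ i′)
      i→i′ = subst (CyclicSucc L (toℕ i) ∘ toℕ) (f-inj (next i) i′ fni≡fi′) (proj₂ (cyclicSucc i))

  cycleIn : (cyc : Cycle G S) → (∀ i → Cycle.vtx cyc i ∈ T) → Cycle G T
  cycleIn cyc vtx∈T = record { Cycle cyc hiding (vtx-in) ; vtx-in = vtx∈T }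

  CycleThrough : Subset n → Fin n → Set
  CycleThrough S v = ∃ λ (cyc : Cycle G S) → ∃ λ i → Cycle.vtx cyc i ≡ v

  cycleThrough-mono : S ⊆ T → CycleThrough S v → CycleThrough T v
  cycleThrough-mono S⊆T (cyc , i , vtx≡v) = cycleIn cyc (S⊆T ∘ Cycle.vtx-in cyc) , i , vtx≡v

  simplePath⇒cycleThrough : v ∉ S → SimplePath S a b → a ≢ b → Adj G v a → Adj G v b →
                            CycleThrough (S ∪ ⁅ v ⁆) v
  simplePath⇒cycleThrough {v = v} {S = S} {a = a} {b = b} v∉S P a≢b v~a v~b =
    mkCycle (suc (suc len)) (s≤s (s≤s 1≤len)) f f-inj f-in f-adj , zero , refl
    where
    open SimplePath P
    1≤len : 1 ≤ len
    1≤len with len in len≡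
    ... | zero  = contradiction (trans (sym vtx-first) (vtx-last zero (sym len≡))) a≢b
    ... | suc _ = s≤s z≤n
    f : Fin (suc (suc len)) → Fin n
    f zero    = v
    f (suc i) = vtx i
    f-inj : ∀ i j → f i ≡ f j → i ≡ j
    f-inj zero    zero    _   = refl
    f-inj zero    (suc j) v≡  = contradiction (subst (_∈ S) (sym v≡) (vtx-in j)) v∉S
    f-inj (suc i) zero    ≡v  = contradiction (subst (_∈ S) ≡v (vtx-in i)) v∉S
    f-inj (suc i) (suc j) i≡j = cong suc (vtx-inj i j i≡j)
    f-in : ∀ i → f i ∈ S ∪ ⁅ v ⁆
    f-in zero    = x∈p∪q⁺ (inj₂ (x∈⁅x⁆ v))
    f-in (suc i) = x∈p∪q⁺ (inj₁ (vtx-in i))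
    f-adj : ∀ i j → CyclicSucc (suc (suc len)) (toℕ i) (toℕ j) → Adj G (f i) (f j)
    f-adj zero    (suc zero) _                 = subst (Adj G v) (sym vtx-first) v~a
    f-adj (suc i) zero       (inj₂ (i+2≡L , _)) =
      subst (λ x → Adj G x v) (sym (vtx-last i (suc-injective (suc-injective i+2≡L)))) (Adj-sym v~b)
    f-adj (suc i) (suc j)    (inj₁ e)          = link i j (suc-injective e)
    f-adj zero    zero          (inj₁ ())
    f-adj zero    zero          (inj₂ (() , _))
    f-adj zero    (suc (suc _)) (inj₁ ())
    f-adj zero    (suc (suc _)) (inj₂ (_ , ()))
    f-adj (suc _) zero          (inj₁ ())
    f-adj (suc _) (suc _)       (inj₂ (_ , ()))

  module _ (cyc : Cycle G S) where
    open Cycle cyc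

    reach-along-arc : ∀ i j → toℕ i ≤ toℕ j → (∀ k → toℕ i ≤ toℕ k → toℕ k ≤ toℕ j → vtx k ∈ T) →
                      Reach G T (vtx i) (vtx j)
    reach-along-arc {T = T} i j i≤j between∈T =
      subst₂ (Reach G T) (vtxAt-toℕ i) (vtxAt-toℕ j) (go (toℕ j) i≤j (toℕ<n j) ≤-refl)
      where
      -- The bound is irrelevant, so vtxAt t does not depend on which proof of t < len is given.
      vtxAt : (t : ℕ) → .(t < len) → Fin n
      vtxAt t t<len = vtx (fromℕ< t<len)
      vtxAt-toℕ : ∀ k → vtxAt (toℕ k) (toℕ<n k) ≡ vtx k
      vtxAt-toℕ k = cong vtx (fromℕ<-toℕ k (toℕ<n k))
      vtxAt∈T : ∀ t → (t<len : t < len) → toℕ i ≤ t → t ≤ toℕ j → vtxAt t t<len ∈ T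
      vtxAt∈T t t<len i≤t t≤j = between∈T (fromℕ< t<len)
        (subst (toℕ i ≤_) (sym (toℕ-fromℕ< t<len)) i≤t) (subst (_≤ toℕ j) (sym (toℕ-fromℕ< t<len)) t≤j)
      go : ∀ t → toℕ i ≤ t → (t<len : t < len) → t ≤ toℕ j →
           Reach G T (vtxAt (toℕ i) (toℕ<n i)) (vtxAt t t<len)
      go t i≤t t<len t≤j with m≤n⇒m<n∨m≡n i≤t
      ... | inj₂ refl = here (vtxAt∈T t t<len i≤t t≤j)
      go (suc t) _ t+1<len t+1≤j | inj₁ (s≤s i≤t) =
        reach-trans (go t i≤t t<len t≤j)
                    (reach-edge (vtxAt∈T t t<len i≤t t≤j) (vtxAt∈T (suc t) t+1<len (m≤n⇒m≤1+n i≤t) t+1≤j)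
                                (Joins⇒Adj (link _ _ (inj₁ t+1≡t+1))))
        where
        t≤j = ≤-trans (n≤1+n t) t+1≤j
        t<len : t < len
        t<len = <-trans (n<1+n t) t+1<len
        t+1≡t+1 : suc (toℕ (fromℕ< t<len)) ≡ toℕ (fromℕ< t+1<len)
        t+1≡t+1 = trans (cong suc (toℕ-fromℕ< t<len)) (sym (toℕ-fromℕ< t+1<len))

    reach-along-cycle-avoiding : (∀ k → vtx k ≢ u → vtx k ∈ T) →
                                 ∀ i j → vtx i ≢ u → vtx j ≢ u → Reach G T (vtx i) (vtx j)
    reach-along-cycle-avoiding {u = u} {T = T} off-u∈T i j vi≢u vj≢u =
      [ (λ i≤j → ordered i j i≤j vi≢u vj≢u) , (λ j≤i → reach-sym (ordered j i j≤i vj≢u vi≢u)) ]′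
      (≤-total (toℕ i) (toℕ j))
      where
      0<len : 0 < len
      0<len = ≤-trans (s≤s z≤n) len≥2
      instance
        len≢0 : NonZero len
        len≢0 = >-nonZero 0<len
      firstIx lastIx : Fin len
      firstIx = fromℕ< 0<len
      lastIx  = fromℕ< (≤-reflexive (suc-pred len))
      wrap : Adj G (vtx lastIx) (vtx firstIx)
      wrap = Joins⇒Adj (link lastIx firstIx (inj₂
        (trans (cong suc (toℕ-fromℕ< (≤-reflexive (suc-pred len)))) (suc-pred len) , toℕ-fromℕ< 0<len)))
      ordered : ∀ i j → toℕ i ≤ toℕ j → vtx i ≢ u → vtx j ≢ u → Reach G T (vtx i) (vtx j)
      ordered i j i≤j vi≢u vj≢u with any? (λ p → (toℕ i ≤? toℕ p) ×-dec (toℕ p ≤? toℕ j) ×-dec (vtx p ≟ u))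
      ... | no u∉[i,j] =
        reach-along-arc i j i≤j (λ k i≤k k≤j → off-u∈T k (λ vk≡u → u∉[i,j] (k , i≤k , k≤j , vk≡u)))
      -- u sits between i and j, so go round the other way, through the edge from last to first index.
      ... | yes (p , i≤p , p≤j , vp≡u) = reach-sym (reach-trans j⇝last (reach-trans last⇝first first⇝i))
        where
        ≡p : ∀ {k} → vtx k ≡ u → toℕ k ≡ toℕ p
        ≡p vk≡u = cong toℕ (vtx-inj _ p (trans vk≡u (sym vp≡u)))
        j⇝last : Reach G T (vtx j) (vtx lastIx)
        j⇝last = reach-along-arc j lastIx (subst (toℕ j ≤_) (sym (toℕ-fromℕ< _)) (<⇒≤pred (toℕ<n j)))
          λ k j≤k _ → off-u∈T k λ vk≡u →
            vj≢u (trans (cong vtx (toℕ-injective (≤-antisym (subst (toℕ j ≤_) (≡p vk≡u) j≤k) p≤j))) vp≡u)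
        first⇝i : Reach G T (vtx firstIx) (vtx i)
        first⇝i = reach-along-arc firstIx i (subst (_≤ toℕ i) (sym (toℕ-fromℕ< 0<len)) z≤n)
          λ k _ k≤i → off-u∈T k λ vk≡u →
            vi≢u (trans (cong vtx (toℕ-injective (≤-antisym i≤p (subst (_≤ toℕ i) (≡p vk≡u) k≤i)))) vp≡u)
        last⇝first : Reach G T (vtx lastIx) (vtx firstIx)
        last⇝first = reach-edge (reach-end j⇝last) (reach-start first⇝i) wrap

  AttachedAt : Subset n → Fin n → Set
  AttachedAt C v = ∀ {x y} → x ∈ C → Adj G x y → y ∉ C → y ≡ v

  attached-reach : AttachedAt C v → v ∉ T → Reach G T x y → x ∈ C → y ∈ C
  attached-reach C⊸v v∉T (here _)                  x∈C = x∈C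
  attached-reach {C = C} {T = T} C⊸v v∉T (step {b = z} _ x~z z⇝y) x∈C with z ∈? C
  ... | yes z∈C = attached-reach C⊸v v∉T z⇝y z∈C
  ... | no  z∉C = contradiction (subst (_∈ T) (C⊸v x∈C x~z z∉C) (reach-start z⇝y)) v∉T

  attached-cycle : AttachedAt C v → v ∉ C → (cyc : Cycle G S) → ∀ {i} → Cycle.vtx cyc i ∈ C →
                   ∀ j → Cycle.vtx cyc j ≢ v → Cycle.vtx cyc j ∈ C
  attached-cycle {C = C} {v = v} C⊸v v∉C cyc {i} vi∈C j vj≢v =
    attached-reach C⊸v (λ v∈ → x∈∁p⇒x∉p v∈ (x∈⁅x⁆ v))
      (reach-along-cycle-avoiding cyc (λ _ ≢v → x∉p⇒x∈∁p (x≢y⇒x∉⁅y⁆ ≢v)) i j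
        (λ vi≡v → v∉C (subst (_∈ C) vi≡v vi∈C)) vj≢v)
      vi∈C

  attached-bypass : AttachedAt C v → Reach G S x y → y ∉ C →
                    (x ∉ C → Reach G (S ∩ ∁ C) x y) × (x ∈ C → Reach G (S ∩ ∁ C) v y)
  attached-bypass C⊸v (here x∈S) y∉C =
    (λ x∉C → here (x∈p∩q⁺ (x∈S , x∉p⇒x∈∁p x∉C))) , (λ x∈C → contradiction x∈C y∉C)
  attached-bypass {C = C} {v = v} {S = S} {y = y} C⊸v (step {a = x} {b = z} x∈S x~z z⇝y) y∉C =
    from-outside , from-inside
    where
    from-z = attached-bypass C⊸v z⇝y y∉C
    from-outside : x ∉ C → Reach G (S ∩ ∁ C) x y
    from-outside x∉C with z ∈? C
    ... | yes z∈C = subst (λ w → Reach G (S ∩ ∁ C) w y) (sym (C⊸v z∈C (Adj-sym x~z) x∉C)) (proj₂ from-z z∈C)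
    ... | no  z∉C = step (x∈p∩q⁺ (x∈S , x∉p⇒x∈∁p x∉C)) x~z (proj₁ from-z z∉C)
    from-inside : x ∈ C → Reach G (S ∩ ∁ C) v y
    from-inside x∈C with z ∈? C
    ... | yes z∈C = proj₂ from-z z∈C
    ... | no  z∉C = subst (λ w → Reach G (S ∩ ∁ C) w y) (C⊸v x∈C x~z z∉C) (proj₁ from-z z∉C)

  component-⊆ : T ⊆ S → D ⊆ T → IsComponent G S D → IsComponent G T D
  component-⊆ T⊆S D⊆T (nonempty , _ , D-connected , D-closed) =
    nonempty , D⊆T , D-connected , λ a b a∈D b∈T a⇝b → D-closed a b a∈D (T⊆S b∈T) (reach-mono T⊆S a⇝b)

  component-minus-attached : AttachedAt C v → v ∉ C → v ∈ D → IsComponent G S D →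
                             IsComponent G (∁ C ∩ S) (D ∩ ∁ C)
  component-minus-attached {C = C} {v = v} {D = D} {S = S} C⊸v v∉C v∈D (_ , D⊆S , D-connected , D-closed) =
    (v , x∈p∩q⁺ (v∈D , x∉p⇒x∈∁p v∉C)) ,
    (λ x∈ → x∈p∩q⁺ (proj₂ (x∈p∩q⁻ D (∁ C) x∈) , D⊆S (∈D x∈))) ,
    (λ x y x∈ y∈ → proj₁ (attached-bypass C⊸v (D-connected x y (∈D x∈) (∈D y∈)) (∉C y∈)) (∉C x∈)) ,
    λ x y x∈ y∈ x⇝y → x∈p∩q⁺ (D-closed x y (∈D x∈) (∈S y∈) (reach-mono ∈S x⇝y) , proj₁ (x∈p∩q⁻ (∁ C) S y∈))
    where
    ∈D : x ∈ D ∩ ∁ C → x ∈ D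
    ∈D = proj₁ ∘ x∈p∩q⁻ D (∁ C)
    ∉C : x ∈ D ∩ ∁ C → x ∉ C
    ∉C = x∈∁p⇒x∉p ∘ proj₂ ∘ x∈p∩q⁻ D (∁ C)
    ∈S : x ∈ ∁ C ∩ S → x ∈ S
    ∈S = proj₂ ∘ x∈p∩q⁻ (∁ C) S

  cliqueOrTree-⊆ : D ⊆ K → (∃ λ a → a ∈ D) → Connected G D →
                   IsClique G K ⊎ IsTree G K → IsClique G D ⊎ IsTree G D
  cliqueOrTree-⊆ D⊆K _ _ (inj₁ K-clique) =
    inj₁ λ a b a∈D b∈D a≢b → K-clique a b (D⊆K a∈D) (D⊆K b∈D) a≢b
  cliqueOrTree-⊆ D⊆K nonempty D-connected (inj₂ (_ , _ , K-acyclic)) =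
    inj₂ (nonempty , D-connected , λ cyc → K-acyclic (cycleIn cyc (D⊆K ∘ Cycle.vtx-in cyc)))

  solution-restrict : T ⊆ S → Solution G S k X → Solution G T k (X ∩ T)
  solution-restrict {T = T} {S = S} {X = X} T⊆S (_ , ∣X∣≤k , X-solves) =
    proj₂ ∘ x∈p∩q⁻ X T , ≤-trans (∣p∩q∣≤∣p∣ X T) ∣X∣≤k , solves
    where
    solves : ∀ D → IsComponent G (T ∩ ∁ (X ∩ T)) D → IsClique G D ⊎ IsTree G D
    solves D ((a , a∈D) , D⊆ , D-connected , _) =
      cliqueOrTree-⊆ D⊆comp (a , a∈D) D-connected (X-solves comp (componentOf-isComponent (kept a∈D)))
      where
      kept : x ∈ D → x ∈ S ∩ ∁ X
      kept x∈D with x∈p∩q⁻ T _ (D⊆ x∈D)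
      ... | x∈T , x∉X∩T = x∈p∩q⁺ (T⊆S x∈T , x∉p⇒x∈∁p λ x∈X → x∈∁p⇒x∉p x∉X∩T (x∈p∩q⁺ (x∈X , x∈T)))
      comp : Subset n
      comp = componentOf (S ∩ ∁ X) a
      D⊆comp : D ⊆ comp
      D⊆comp x∈D = ∈componentOf⁺ (reach-mono kept (D-connected a _ a∈D x∈D))

module TreeComponentRemoval
  {n : ℕ} (G : Graph n) (k : ℕ) (1≤k : 1 ≤ k) (v : Fin n) (v-large : LargeSparse G k v)
  (B : Subset n) (v∉B : v ∉ B) (∣B∣≤2k : ∣ B ∣ ≤ 2 * k)
  (no-cycle-through-v : ¬ GraphProperties.CycleThrough G (∁ B) v)
  (C : Subset n) (C-component : IsComponent G (∁ (B ∪ ⁅ v ⁆)) C)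
  (v-touches-C : ∃ λ a → a ∈ C × Adj G v a) (C-tree : IsTree G C)
  (C≁B : ∀ a b → a ∈ C → b ∈ B → ¬ Adj G a b) where

  open GraphProperties G

  private
    variable
      x y : Fin n
      D S T Y : Subset n

  V-B-v : Subset n
  V-B-v = ∁ (B ∪ ⁅ v ⁆)

  ∉B∧≢v⇒∈V-B-v : x ∉ B → x ≢ v → x ∈ V-B-v
  ∉B∧≢v⇒∈V-B-v x∉B x≢v = x∉p⇒x∈∁p λ x∈ → [ x∉B , x≢v ∘ x∈⁅y⁆⇒x≡y v ]′ (x∈p∪q⁻ B ⁅ v ⁆ x∈)

  v∉V-B-v : v ∉ V-B-v
  v∉V-B-v v∈ = x∈∁p⇒x∉p v∈ (x∈p∪q⁺ (inj₂ (x∈⁅x⁆ v)))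

  V-B-v∪v⊆∁B : V-B-v ∪ ⁅ v ⁆ ⊆ ∁ B
  V-B-v∪v⊆∁B x∈ with x∈p∪q⁻ V-B-v ⁅ v ⁆ x∈
  ... | inj₁ x∈V-B-v = x∉p⇒x∈∁p λ x∈B → x∈∁p⇒x∉p x∈V-B-v (x∈p∪q⁺ (inj₁ x∈B))
  ... | inj₂ x≡v    = x∉p⇒x∈∁p λ x∈B → v∉B (subst (_∈ B) (x∈⁅y⁆⇒x≡y v x≡v) x∈B)

  C⊆V-B-v : C ⊆ V-B-v
  C⊆V-B-v = proj₁ (proj₂ C-component)

  C-connected : Connected G C
  C-connected = proj₁ (proj₂ (proj₂ C-component))

  v∉C : v ∉ C
  v∉C = v∉V-B-v ∘ C⊆V-B-v

  C-disjoint-B : x ∈ C → x ∉ B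
  C-disjoint-B x∈C x∈B = x∈∁p⇒x∉p (C⊆V-B-v x∈C) (x∈p∪q⁺ (inj₁ x∈B))

  C-attached : AttachedAt C v
  C-attached {x} {y} x∈C x~y y∉C with y ≟ v | y ∈? B
  ... | yes y≡v | _       = y≡v
  ... | no  _   | yes y∈B = contradiction x~y (C≁B x y x∈C y∈B)
  ... | no  y≢v | no  y∉B = contradiction (C-closed x y x∈C y∈ (reach-edge (C⊆V-B-v x∈C) y∈ x~y)) y∉C
    where
    y∈ = ∉B∧≢v⇒∈V-B-v y∉B y≢v
    C-closed = proj₂ (proj₂ (proj₂ C-component))

  neighbours-equal : Reach G V-B-v x y → Adj G v x → Adj G v y → x ≡ y
  neighbours-equal {x} {y} x⇝y v~x v~y with x ≟ y
  ... | yes x≡y = x≡y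
  ... | no  x≢y = contradiction
    (cycleThrough-mono V-B-v∪v⊆∁B (simplePath⇒cycleThrough v∉V-B-v (simplePath x⇝y) x≢y v~x v~y))
    no-cycle-through-v

  cycle-avoids-C : (cyc : Cycle G S) → ∀ i → Cycle.vtx cyc i ∉ C
  cycle-avoids-C cyc i vi∈C with any? (λ j → Cycle.vtx cyc j ≟ v)
  ... | yes (j , vj≡v) = no-cycle-through-v (cycleIn cyc ∈∁B , j , vj≡v)
    where
    ∈∁B : ∀ j → Cycle.vtx cyc j ∈ ∁ B
    ∈∁B j with Cycle.vtx cyc j ≟ v
    ... | yes vj≡v = x∉p⇒x∈∁p (subst (_∉ B) (sym vj≡v) v∉B)
    ... | no  vj≢v = x∉p⇒x∈∁p (C-disjoint-B (attached-cycle C-attached v∉C cyc vi∈C j vj≢v))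
  ... | no v∉cyc = proj₂ (proj₂ C-tree)
    (cycleIn cyc λ j → attached-cycle C-attached v∉C cyc vi∈C j (λ vj≡v → v∉cyc (j , vj≡v)))

  ∣N[v]∩C∣≤1 : ∣ nbhd G v ∩ C ∣ ≤ 1
  ∣N[v]∩C∣≤1 = subsingleton⇒∣p∣≤1 (nbhd G v ∩ C) λ {x} {y} x∈ y∈ →
    let (x∈N , x∈C) = x∈p∩q⁻ (nbhd G v) C x∈
        (y∈N , y∈C) = x∈p∩q⁻ (nbhd G v) C y∈
    in neighbours-equal (reach-mono C⊆V-B-v (C-connected x y x∈C y∈C)) (∈nbhd⇒Adj x∈N) (∈nbhd⇒Adj y∈N)

  ∣N[v]-C∪Y∪B∣≤1 : IsClique G T → (∀ {x} → Adj G v x → x ∉ C → x ∉ Y → x ∈ T) →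
                  ∣ nbhd G v ∩ ∁ (C ∪ (Y ∪ B)) ∣ ≤ 1
  ∣N[v]-C∪Y∪B∣≤1 {T = T} {Y = Y} T-clique neighbours∈T = subsingleton⇒∣p∣≤1 _ subsingleton
    where
    v~ : x ∈ nbhd G v ∩ ∁ (C ∪ (Y ∪ B)) → Adj G v x
    v~ = ∈nbhd⇒Adj ∘ proj₁ ∘ x∈p∩q⁻ (nbhd G v) _
    ∉C∪Y∪B : x ∈ nbhd G v ∩ ∁ (C ∪ (Y ∪ B)) → x ∉ C ∪ (Y ∪ B)
    ∉C∪Y∪B = x∈∁p⇒x∉p ∘ proj₂ ∘ x∈p∩q⁻ (nbhd G v) _
    ∈T : x ∈ nbhd G v ∩ ∁ (C ∪ (Y ∪ B)) → x ∈ T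
    ∈T x∈ = neighbours∈T (v~ x∈) (∉C∪Y∪B x∈ ∘ x∈p∪q⁺ ∘ inj₁) (∉C∪Y∪B x∈ ∘ x∈p∪q⁺ ∘ inj₂ ∘ x∈p∪q⁺ ∘ inj₁)
    ∈V-B-v : x ∈ nbhd G v ∩ ∁ (C ∪ (Y ∪ B)) → x ∈ V-B-v
    ∈V-B-v x∈ = ∉B∧≢v⇒∈V-B-v (∉C∪Y∪B x∈ ∘ x∈p∪q⁺ ∘ inj₂ ∘ x∈p∪q⁺ ∘ inj₂)
                             (λ x≡v → Adj-irrefl (subst (Adj G v) x≡v (v~ x∈)))
    subsingleton : x ∈ nbhd G v ∩ ∁ (C ∪ (Y ∪ B)) → y ∈ nbhd G v ∩ ∁ (C ∪ (Y ∪ B)) → x ≡ y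
    subsingleton {x} {y} x∈ y∈ with x ≟ y
    ... | yes x≡y = x≡y
    ... | no  x≢y = neighbours-equal
      (reach-edge (∈V-B-v x∈) (∈V-B-v y∈) (edgeCount≡1⇒Adj (T-clique x y (∈T x∈) (∈T y∈) x≢y)))
      (v~ x∈) (v~ y∈)

  degree-bound : ∣ Y ∣ ≤ k → IsClique G T → (∀ {x} → Adj G v x → x ∉ C → x ∉ Y → x ∈ T) →
                 ∣ nbhd G v ∣ ≤ k + (2 * k + 2)
  degree-bound {Y = Y} ∣Y∣≤k T-clique neighbours∈T = begin
    ∣ N ∣                              ≤⟨ p⊆q⇒∣p∣≤∣q∣ cover ⟩
    ∣ Y ∪ (B ∪ (N ∩ C ∪ R)) ∣          ≤⟨ ∣p∪q∣≤∣p∣+∣q∣ Y _ ⟩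
    ∣ Y ∣ + ∣ B ∪ (N ∩ C ∪ R) ∣        ≤⟨ +-mono-≤ ∣Y∣≤k (∣p∪q∣≤∣p∣+∣q∣ B _) ⟩
    k + (∣ B ∣ + ∣ N ∩ C ∪ R ∣)        ≤⟨ +-monoʳ-≤ k (+-mono-≤ ∣B∣≤2k (∣p∪q∣≤∣p∣+∣q∣ (N ∩ C) R)) ⟩
    k + (2 * k + (∣ N ∩ C ∣ + ∣ R ∣))  ≤⟨ +-monoʳ-≤ k (+-monoʳ-≤ (2 * k) (+-mono-≤ ∣N[v]∩C∣≤1 R≤1)) ⟩
    k + (2 * k + 2)                    ∎
    where
    open ≤-Reasoning
    N R : Subset n
    N = nbhd G v
    R = N ∩ ∁ (C ∪ (Y ∪ B))
    R≤1 : ∣ R ∣ ≤ 1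
    R≤1 = ∣N[v]-C∪Y∪B∣≤1 T-clique neighbours∈T
    cover : N ⊆ Y ∪ (B ∪ (N ∩ C ∪ R))
    cover {x} x∈N with x ∈? C | x ∈? Y | x ∈? B
    ... | yes x∈C | _       | _       = x∈p∪q⁺ (inj₂ (x∈p∪q⁺ (inj₂ (x∈p∪q⁺ (inj₁ (x∈p∩q⁺ (x∈N , x∈C)))))))
    ... | no  _   | yes x∈Y | _       = x∈p∪q⁺ (inj₁ x∈Y)
    ... | no  _   | no  _   | yes x∈B = x∈p∪q⁺ (inj₂ (x∈p∪q⁺ (inj₁ x∈B)))
    ... | no  x∉C | no  x∉Y | no  x∉B = x∈p∪q⁺ (inj₂ (x∈p∪q⁺ (inj₂ (x∈p∪q⁺ (inj₂ (x∈p∩q⁺ (x∈N , x∉p⇒x∈∁p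
      λ x∈ → [ x∉C , [ x∉Y , x∉B ]′ ∘ x∈p∪q⁻ Y B ]′ (x∈p∪q⁻ C (Y ∪ B) x∈))))))))

  no-clique-around-v : ∣ Y ∣ ≤ k → IsClique G T → (∀ {x} → Adj G v x → x ∉ C → x ∉ Y → x ∈ T) → ⊥
  no-clique-around-v ∣Y∣≤k T-clique neighbours∈T =
    <⇒≱ (proj₁ v-large) (≤-trans (degree-bound ∣Y∣≤k T-clique neighbours∈T) (k+2k+2≤7k 1≤k))

  component-meeting-C-isTree : Solution G (∁ C) k Y → IsComponent G (∁ Y) D → x ∈ D → x ∈ C →
                               IsTree G D
  component-meeting-C-isTree {Y = Y} {D = D} {x = c} (Y⊆∁C , ∣Y∣≤k , Y-solves)
                             D-component@(_ , D⊆∁Y , D-connected , D-closed) c∈D c∈C =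
    (c , c∈D) , D-connected , D-acyclic
    where
    C⊆∁Y : C ⊆ ∁ Y
    C⊆∁Y x∈C = x∉p⇒x∈∁p λ x∈Y → x∈∁p⇒x∉p (Y⊆∁C x∈Y) x∈C
    v∈D : v ∉ Y → v ∈ D
    v∈D v∉Y = let (a , a∈C , v~a) = v-touches-C in
      D-closed c v c∈D (x∉p⇒x∈∁p v∉Y) (reach-trans (reach-mono C⊆∁Y (C-connected c a c∈C a∈C))
                                                   (reach-edge (C⊆∁Y a∈C) (x∉p⇒x∈∁p v∉Y) (Adj-sym v~a)))
    D-acyclic : ¬ Cycle G D
    D-acyclic cyc with v ∈? Y
    ... | yes v∈Y = cycle-avoids-C cyc i₀
      (attached-reach C-attached (λ v∈∁Y → x∈∁p⇒x∉p v∈∁Y v∈Y)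
        (reach-mono D⊆∁Y (D-connected c _ c∈D (Cycle.vtx-in cyc i₀))) c∈C)
      where
      i₀ : Fin (Cycle.len cyc)
      i₀ = fromℕ< (≤-trans (s≤s z≤n) (Cycle.len≥2 cyc))
    ... | no v∉Y with Y-solves (D ∩ ∁ C) (component-minus-attached C-attached v∉C (v∈D v∉Y) D-component)
    ...   | inj₁ D∖C-clique = ⊥-elim (no-clique-around-v ∣Y∣≤k D∖C-clique λ v~x x∉C x∉Y →
            x∈p∩q⁺ (D-closed v _ (v∈D v∉Y) (x∉p⇒x∈∁p x∉Y) (reach-edge (x∉p⇒x∈∁p v∉Y) (x∉p⇒x∈∁p x∉Y) v~x) ,
                    x∉p⇒x∈∁p x∉C))
    ...   | inj₂ (_ , _ , D∖C-acyclic) =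
            D∖C-acyclic (cycleIn cyc λ j → x∈p∩q⁺ (Cycle.vtx-in cyc j , x∉p⇒x∈∁p (cycle-avoids-C cyc j)))

  solution-extend : Solution G (∁ C) k Y → Solution G ⊤ k Y
  solution-extend {Y = Y} Y-solution@(_ , ∣Y∣≤k , Y-solves) =
    (λ _ → ∈⊤) , ∣Y∣≤k , λ D → solves D ∘ subst (λ S → IsComponent G S D) (∩-identityˡ (∁ Y))
    where
    solves : ∀ D → IsComponent G (∁ Y) D → IsClique G D ⊎ IsTree G D
    solves D D-component with any? (λ x → x ∈? D ×-dec x ∈? C)
    ... | yes (c , c∈D , c∈C) = inj₂ (component-meeting-C-isTree Y-solution D-component c∈D c∈C)
    ... | no  D∩C≡∅           = Y-solves D (component-⊆ (proj₂ ∘ x∈p∩q⁻ (∁ C) (∁ Y)) D⊆∁C∩∁Y D-component)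
      where
      D⊆∁C∩∁Y : D ⊆ ∁ C ∩ ∁ Y
      D⊆∁C∩∁Y x∈D = x∈p∩q⁺ (x∉p⇒x∈∁p (λ x∈C → D∩C≡∅ (_ , x∈D , x∈C)) , proj₁ (proj₂ D-component) x∈D)

lemma10 : ∀ {n : ℕ} (G : Graph n) (k : ℕ) → 1 ≤ k →
    (v : Fin n) → LargeSparse G k v →
    (B : Subset n) → v ∉ B → ∣ B ∣ ≤ 2 * k →
    ¬ (∃ λ (cyc : Cycle G (∁ B)) → ∃ λ i → Cycle.vtx cyc i ≡ v) →
    (C : Subset n) →
    IsComponent G (∁ (B ∪ ⁅ v ⁆)) C →
    (∃ λ a → a ∈ C × Adj G v a) →
    IsTree G C →
    (∀ a b → a ∈ C → b ∈ B → ¬ Adj G a b) →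
    YesInstance G ⊤ k ⇔ YesInstance G (∁ C) k
lemma10 G k 1≤k v v-large B v∉B ∣B∣≤2k no-cycle-through-v C C-component v-touches-C C-tree C≁B =
  mk⇔ (λ (X , X-solution) → X ∩ ∁ C , solution-restrict (λ _ → ∈⊤) X-solution)
      (λ (Y , Y-solution) → Y , solution-extend Y-solution)
  where
  open GraphProperties G using (solution-restrict)
  open TreeComponentRemoval G k 1≤k v v-large B v∉B ∣B∣≤2k no-cycle-through-v C C-component v-touches-C C-tree C≁B
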